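{- For every integer $k\ge 5$ we have $m_2^{(k-3)}(k-1,k-2)=k+1$.
   Context: For a prime power $q$, integers $0\le r< N$ and $w\ge 0$, $m_q^{(r)}(N,w)$ denotes the maximum total multiplicity of a multiset of points in the projective space $\mathrm{PG}(N,q)$ (a map $\mathcal{M}$ from points to nonnegative integers) such that every $r$-dimensional projective subspace $S$ has multiplicity $\sum_{P\in S}\mathcal{M}(P)\le w$. -}

module Defs where

open import Data.Bool using (Bool; true; false; if_then_else_; _xor_)
open import Data.Nat using (ℕ; zero; suc; _≤_)
open import Data.List using (List; []; _∷_; map; filter; _++_)
open import Data.Nat.ListAction using (sum)
open import Data.Vec using (Vec; []; _∷_; replicate; zipWith)
import Data.Vec.Properties as VecP
import Data.Bool.Properties as BoolP
open import Data.Product using (Σ; _×_; _,_)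
open import Relation.Binary.PropositionalEquality using (_≡_)
open import Relation.Nullary using (¬?)

-- Vectors of F_2^n, with F_2 = Bool (addition = xor).
zeroVec : (n : ℕ) → Vec Bool n
zeroVec n = replicate n false

_⊕_ : {n : ℕ} → Vec Bool n → Vec Bool n → Vec Bool n
_⊕_ = zipWith _xor_

allVecs : (n : ℕ) → List (Vec Bool n)
allVecs zero = [] ∷ []
allVecs (suc n) = map (false ∷_) (allVecs n) ++ map (true ∷_) (allVecs n)

nonzeroVecs : (n : ℕ) → List (Vec Bool n)
nonzeroVecs n = filter (λ v → ¬? (VecP.≡-dec BoolP._≟_ v (zeroVec n))) (allVecs n)

-- Points of PG(N,2): the nonzero vectors of F_2^(N+1) (each projective point
-- has exactly one nonzero representative over F_2).
points : (N : ℕ) → List (Vec Bool (suc N))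
points N = nonzeroVecs (suc N)

comb : {n k : ℕ} → Vec (Vec Bool n) k → Vec Bool k → Vec Bool n
comb {n} [] [] = zeroVec n
comb (v ∷ vs) (c ∷ cs) = if c then v ⊕ comb vs cs else comb vs cs

LinIndep : {n k : ℕ} → Vec (Vec Bool n) k → Set
LinIndep {n} {k} b = (c : Vec Bool k) → comb b c ≡ zeroVec n → c ≡ zeroVec k

-- A multiset of points of PG(N,2) (the value at the zero vector is irrelevant).
Multiset : ℕ → Set
Multiset N = Vec Bool (suc N) → ℕ

totalMult : {N : ℕ} → Multiset N → ℕ
totalMult {N} M = sum (map M (points N))

-- Multiplicity of the r-dimensional projective subspace spanned by the
-- (linearly independent) basis b of r+1 vectors: sum of M over its points
-- (the nonzero combinations of b, each point counted once by independence).
subspaceMult : {N r : ℕ} → Multiset N → Vec (Vec Bool (suc N)) (suc r) → ℕ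
subspaceMult {N} {r} M b = sum (map (λ c → M (comb b c)) (nonzeroVecs (suc r)))

Admissible : (N r w : ℕ) → Multiset N → Set
Admissible N r w M =
  (b : Vec (Vec Bool (suc N)) (suc r)) → LinIndep b → subspaceMult M b ≤ w

-- m_2^{(r)}(N,w) = m  (m is the maximum total multiplicity).
IsM2 : (r N w m : ℕ) → Set
IsM2 r N w m =
  (Σ (Multiset N) λ M → Admissible N r w M × totalMult M ≡ m)
  × ((M : Multiset N) → Admissible N r w M → totalMult M ≤ m)

module Submission where

-- Lower bound: the frame e₁, …, e_k, e₁ + ⋯ + e_k consists of k + 1 points any k of
-- which are independent, so every span of k − 2 independent vectors contains at most
-- k − 2 of them.
--
-- Upper bound: k + 2 points of F₂ᵏ admit two different nontrivial dependencies a and b.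
-- Every coordinate is set in at most two of a, b, a + b, so one of these three
-- dependencies has weight at most 2(k + 2)/3, which is at most k − 1 because k ≥ 5.
-- Padding its support to k − 1 of the points gives k − 1 dependent points; they lie in
-- a subspace spanned by k − 2 independent vectors, whose multiplicity is then at least
-- k − 1.
--
-- The linear algebra needed over F₂ (more than n vectors of F₂ⁿ are dependent, a basis
-- can be chosen through given vectors) follows by induction on n, projecting from a
-- nonzero point.

open import Defs
open import Algebra.Bundles using (AbelianGroup)
open import Algebra.Structures using (IsAbelianGroup)
import Algebra.Properties.AbelianGroup as AbelianGroupProperties
import Algebra.Properties.CommutativeSemigroup as CommutativeSemigroupProperties
open import Data.Bool using (Bool; true; false; _xor_; if_then_else_)
import Data.Bool.Properties as BoolP
open import Data.Empty using (⊥-elim)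
open import Data.Fin using (Fin; zero; suc)
open import Data.Fin.Subset using (∣_∣; _⊆_)
open import Data.Fin.Subset.Properties
  using (anySubset?; nonempty?; Empty-unique; ∣p∣≤n; ∣⊤∣≡n; ⊆-refl; drop-∷-⊆; in⊆in; out⊆; s⊆s)
open import Data.List as L using (List; []; _∷_; _++_; filter)
import Data.List.Properties as LP
import Data.List.Relation.Unary.All as ListAll
import Data.List.Relation.Unary.All.Properties as ListAllP
open import Data.Nat using (ℕ; zero; suc; _+_; _*_; _∸_; _≤_; _<_; z≤n; s≤s)
open import Data.Nat.ListAction using (sum)
open import Data.Nat.ListAction.Properties using (sum-++)
open import Data.Nat.Properties
open import Data.Nat.Tactic.RingSolver using (solve-∀)
open import Data.Product using (Σ; ∃; _×_; _,_; proj₁)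
open import Data.Sum using (_⊎_; inj₁; inj₂)
open import Data.Vec as V using (Vec; []; _∷_; replicate; here)
open import Data.Vec.Properties
  using (≡-dec; toList-++; insertAt-lookup; []=⇒lookup; zipWith-assoc; zipWith-comm;
         zipWith-identityˡ; zipWith-identityʳ; ∷-injective; ∷-injectiveˡ; ∷-injectiveʳ)
open import Data.Vec.Relation.Unary.All as All using (All; []; _∷_)
import Data.Vec.Relation.Unary.All.Properties as AllP
open import Function using (id; _∘_)
open import Level using (0ℓ)
open import Relation.Binary.PropositionalEquality hiding ([_])
open import Relation.Binary.PropositionalEquality.Algebra using (isMagma)
open import Relation.Nullary using (¬_; Dec; yes; no; ¬?)
open import Relation.Nullary.Decidable using (decidable-stable; map′)
open import Relation.Unary using (Pred; Decidable)

private
  variable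
    n m d p : ℕ
    A B : Set

∑ : List A → (A → ℕ) → ℕ
∑ xs f = sum (L.map f xs)

infix 6 ∑
syntax ∑ xs (λ x → e) = ∑[ x ∈ xs ] e

∑-++ : ∀ (xs ys : List A) f → ∑ (xs ++ ys) f ≡ ∑ xs f + ∑ ys f
∑-++ xs ys f = trans (cong sum (LP.map-++ f xs ys)) (sum-++ (L.map f xs) (L.map f ys))

∑-map : ∀ (g : A → B) (xs : List A) f → ∑ (L.map g xs) f ≡ ∑ xs (f ∘ g)
∑-map g xs f = cong sum (sym (LP.map-∘ xs))

∑-cong : ∀ {f g : A → ℕ} → (∀ x → f x ≡ g x) → ∀ xs → ∑ xs f ≡ ∑ xs g
∑-cong f≗g xs = cong sum (LP.map-cong f≗g xs)

∑-mono : ∀ {f g : A → ℕ} → (∀ x → f x ≤ g x) → ∀ xs → ∑ xs f ≤ ∑ xs g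
∑-mono f≤g []       = z≤n
∑-mono f≤g (x ∷ xs) = +-mono-≤ (f≤g x) (∑-mono f≤g xs)

∑-zero : ∀ {f : A → ℕ} → (∀ x → f x ≡ 0) → ∀ xs → ∑ xs f ≡ 0
∑-zero f≗0 []       = refl
∑-zero f≗0 (x ∷ xs) = cong₂ _+_ (f≗0 x) (∑-zero f≗0 xs)

∑-+ : ∀ (f g : A → ℕ) xs → ∑[ x ∈ xs ] (f x + g x) ≡ ∑ xs f + ∑ xs g
∑-+ f g []       = refl
∑-+ f g (x ∷ xs) = trans (cong (f x + g x +_) (∑-+ f g xs)) (+-+-comm (f x) (g x) _ _)
  where
  +-+-comm : ∀ a b c d → a + b + (c + d) ≡ a + c + (b + d)
  +-+-comm = solve-∀

module _ {P : Pred A 0ℓ} (P? : Decidable P) where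

  ∑-filter-≤ : ∀ f xs → ∑ (filter P? xs) f ≤ ∑ xs f
  ∑-filter-≤ f []       = z≤n
  ∑-filter-≤ f (x ∷ xs) with P? x
  ... | yes _ = +-monoʳ-≤ (f x) (∑-filter-≤ f xs)
  ... | no  _ = ≤-trans (∑-filter-≤ f xs) (m≤n+m _ (f x))

  ∑-filter : ∀ f → (∀ x → ¬ P x → f x ≡ 0) → ∀ xs → ∑ (filter P? xs) f ≡ ∑ xs f
  ∑-filter f f≗0 []       = refl
  ∑-filter f f≗0 (x ∷ xs) with P? x
  ... | yes _  = cong (f x +_) (∑-filter f f≗0 xs)
  ... | no  ¬p = trans (∑-filter f f≗0 xs) (cong (_+ ∑ xs f) (sym (f≗0 x ¬p)))

-- Linear combinations over F₂

_≟ᵥ_ : (u v : Vec Bool n) → Dec (u ≡ v)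
_≟ᵥ_ = ≡-dec BoolP._≟_

⊕-self : (u : Vec Bool n) → u ⊕ u ≡ zeroVec n
⊕-self []      = refl
⊕-self (x ∷ u) = cong₂ _∷_ (BoolP.xor-same x) (⊕-self u)

⊕-isAbelianGroup : IsAbelianGroup _≡_ (_⊕_ {n}) (zeroVec n) id
⊕-isAbelianGroup = record
  { isGroup = record
    { isMonoid = record
      { isSemigroup = record { isMagma = isMagma _⊕_ ; assoc = zipWith-assoc BoolP.xor-assoc }
      ; identity    = zipWith-identityˡ BoolP.xor-identityˡ , zipWith-identityʳ BoolP.xor-identityʳ
      }
    ; inverse = ⊕-self , ⊕-self
    ; ⁻¹-cong = cong id
    }
  ; comm = zipWith-comm BoolP.xor-comm
  }

⊕-abelianGroup : ℕ → AbelianGroup 0ℓ 0ℓ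
⊕-abelianGroup n = record { isAbelianGroup = ⊕-isAbelianGroup {n} }

module _ {n : ℕ} where
  open AbelianGroup (⊕-abelianGroup n) public
    using () renaming (assoc to ⊕-assoc; identityˡ to ⊕-identityˡ; identityʳ to ⊕-identityʳ)
  open AbelianGroupProperties (⊕-abelianGroup n) public
    using () renaming (inverseˡ-unique to ⊕≡zero⇒≡; //-rightDividesʳ to ⊕-cancelʳ)
  open CommutativeSemigroupProperties (AbelianGroup.commutativeSemigroup (⊕-abelianGroup n)) public
    using () renaming (interchange to ⊕-interchange; x∙yz≈y∙xz to ⊕-left-comm)

⊕-cancel-common : (x a b : Vec Bool n) → (x ⊕ a) ⊕ (x ⊕ b) ≡ a ⊕ b
⊕-cancel-common x a b = begin
  (x ⊕ a) ⊕ (x ⊕ b)    ≡⟨ ⊕-interchange x a x b ⟩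
  (x ⊕ x) ⊕ (a ⊕ b)    ≡⟨ cong (_⊕ (a ⊕ b)) (⊕-self x) ⟩
  zeroVec _ ⊕ (a ⊕ b)  ≡⟨ ⊕-identityˡ _ ⟩
  a ⊕ b                ∎
  where open ≡-Reasoning

comb-zero : (L : Vec (Vec Bool n) m) → comb L (zeroVec m) ≡ zeroVec n
comb-zero []      = refl
comb-zero (v ∷ L) = comb-zero L

comb-⊕ : (L : Vec (Vec Bool n) m) (c e : Vec Bool m) → comb L (c ⊕ e) ≡ comb L c ⊕ comb L e
comb-⊕ []      []          []          = sym (⊕-identityʳ _)
comb-⊕ (v ∷ L) (true ∷ c)  (true ∷ e)  = trans (comb-⊕ L c e) (sym (⊕-cancel-common v _ _))
comb-⊕ (v ∷ L) (true ∷ c)  (false ∷ e) = trans (cong (v ⊕_) (comb-⊕ L c e)) (sym (⊕-assoc v _ _))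
comb-⊕ (v ∷ L) (false ∷ c) (true ∷ e)  = trans (cong (v ⊕_) (comb-⊕ L c e)) (⊕-left-comm v _ _)
comb-⊕ (v ∷ L) (false ∷ c) (false ∷ e) = comb-⊕ L c e

Additive : {n′ : ℕ} → (Vec Bool n → Vec Bool n′) → Set
Additive f = ∀ u v → f (u ⊕ v) ≡ f u ⊕ f v

additive⇒zero : {n′ : ℕ} {f : Vec Bool n → Vec Bool n′} → Additive f → f (zeroVec n) ≡ zeroVec n′
additive⇒zero {n} {f = f} f-⊕ = begin
  f (zeroVec n)                  ≡⟨ cong f (⊕-self _) ⟨
  f (zeroVec n ⊕ zeroVec n)      ≡⟨ f-⊕ _ _ ⟩
  f (zeroVec n) ⊕ f (zeroVec n)  ≡⟨ ⊕-self _ ⟩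
  zeroVec _                      ∎
  where open ≡-Reasoning

comb-map : {n′ : ℕ} {f : Vec Bool n → Vec Bool n′} → Additive f →
           (L : Vec (Vec Bool n) m) (c : Vec Bool m) → comb (V.map f L) c ≡ f (comb L c)
comb-map f-⊕ []      []          = sym (additive⇒zero f-⊕)
comb-map f-⊕ (v ∷ L) (true ∷ c)  = trans (cong (_ ⊕_) (comb-map f-⊕ L c)) (sym (f-⊕ v _))
comb-map f-⊕ (v ∷ L) (false ∷ c) = comb-map f-⊕ L c

comb-injective : {L : Vec (Vec Bool n) m} → LinIndep L → ∀ c e → comb L c ≡ comb L e → c ≡ e
comb-injective {L = L} L-indep c e Lc≡Le = ⊕≡zero⇒≡ c e (L-indep (c ⊕ e) (begin
  comb L (c ⊕ e)       ≡⟨ comb-⊕ L c e ⟩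
  comb L c ⊕ comb L e  ≡⟨ cong (_⊕ comb L e) Lc≡Le ⟩
  comb L e ⊕ comb L e  ≡⟨ ⊕-self _ ⟩
  zeroVec _            ∎))
  where open ≡-Reasoning

linIndep⇒nonzero : {L : Vec (Vec Bool n) m} → LinIndep L → All (_≢ zeroVec n) L
linIndep⇒nonzero {L = []}    _         = []
linIndep⇒nonzero {L = v ∷ L} v∷L-indep =
  v≢0 ∷ linIndep⇒nonzero (λ c Lc≡0 → ∷-injectiveʳ (v∷L-indep (false ∷ c) Lc≡0))
  where
  v≢0 : v ≢ zeroVec _
  v≢0 refl with v∷L-indep (true ∷ zeroVec _) (trans (cong (zeroVec _ ⊕_) (comb-zero L)) (⊕-self _))
  ... | ()

data ZeroView : Vec Bool n → Set where
  zero-vec : ZeroView (zeroVec n)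
  nonzero  : {v : Vec Bool (suc n)} → v ≢ zeroVec (suc n) → ZeroView v

zeroView : (v : Vec Bool n) → ZeroView v
zeroView []      = zero-vec
zeroView (x ∷ v) with (x ∷ v) ≟ᵥ zeroVec _
... | yes refl = zero-vec
... | no  v≢0  = nonzero v≢0

-- Projection from a point

-- For p ≢ 0, π p is linear with kernel {0, p}: it adds p to v when needed to clear the
-- coordinate of the leading one of p, and then drops that coordinate. σ p is a linear
-- section of π p.
π : Vec Bool (suc n) → Vec Bool (suc n) → Vec Bool n
π (true ∷ t)            (x ∷ v) = if x then t ⊕ v else v
π {zero}  (false ∷ [])  _       = []
π {suc n} (false ∷ p)   (x ∷ v) = x ∷ π p v

σ : Vec Bool (suc n) → Vec Bool n → Vec Bool (suc n)
σ (true ∷ _)            u       = false ∷ u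
σ {zero}  (false ∷ [])  []      = false ∷ []
σ {suc n} (false ∷ p)   (x ∷ u) = x ∷ σ p u

π-⊕ : (p : Vec Bool (suc n)) → Additive (π p)
π-⊕ (true ∷ t) (true ∷ u)  (true ∷ v)  = sym (⊕-cancel-common t u v)
π-⊕ (true ∷ t) (true ∷ u)  (false ∷ v) = sym (⊕-assoc t u v)
π-⊕ (true ∷ t) (false ∷ u) (true ∷ v)  = ⊕-left-comm t u v
π-⊕ (true ∷ t) (false ∷ u) (false ∷ v) = refl
π-⊕ {zero}  (false ∷ []) u v = refl
π-⊕ {suc n} (false ∷ p) (x ∷ u) (y ∷ v) = cong ((x xor y) ∷_) (π-⊕ p u v)

σ-⊕ : (p : Vec Bool (suc n)) → Additive (σ p)
σ-⊕ (true ∷ t)           u       v       = refl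
σ-⊕ {zero}  (false ∷ []) []      []      = refl
σ-⊕ {suc n} (false ∷ p)  (x ∷ u) (y ∷ v) = cong ((x xor y) ∷_) (σ-⊕ p u v)

π∘σ : (p : Vec Bool (suc n)) (u : Vec Bool n) → π p (σ p u) ≡ u
π∘σ (true ∷ t)           u       = refl
π∘σ {zero}  (false ∷ []) []      = refl
π∘σ {suc n} (false ∷ p)  (x ∷ u) = cong (x ∷_) (π∘σ p u)

π-self : (p : Vec Bool (suc n)) → π p p ≡ zeroVec n
π-self (true ∷ t)           = ⊕-self t
π-self {zero}  (false ∷ []) = refl
π-self {suc n} (false ∷ p)  = cong (false ∷_) (π-self p)

π-kernel : (p : Vec Bool (suc n)) → p ≢ zeroVec (suc n) →
           ∀ v → π p v ≡ zeroVec n → v ≡ zeroVec (suc n) ⊎ v ≡ p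
π-kernel (true ∷ t) _ (true ∷ v)  πv≡0 = inj₂ (cong (true ∷_) (sym (⊕≡zero⇒≡ t v πv≡0)))
π-kernel (true ∷ t) _ (false ∷ v) πv≡0 = inj₁ (cong (false ∷_) πv≡0)
π-kernel {zero}  (false ∷ []) p≢0 _ _ = ⊥-elim (p≢0 refl)
π-kernel {suc n} (false ∷ p) p≢0 (x ∷ v) πv≡0 with ∷-injective πv≡0
... | refl , πv′≡0 with π-kernel p (p≢0 ∘ cong (false ∷_)) v πv′≡0
...   | inj₁ v≡0 = inj₁ (cong (false ∷_) v≡0)
...   | inj₂ v≡p = inj₂ (cong (false ∷_) v≡p)

π-fibre : (p : Vec Bool (suc n)) → p ≢ zeroVec (suc n) →
          ∀ v → v ≡ σ p (π p v) ⊎ v ≡ p ⊕ σ p (π p v)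
π-fibre p p≢0 v with π-kernel p p≢0 (v ⊕ σ p (π p v)) (begin
    π p (v ⊕ σ p (π p v))      ≡⟨ π-⊕ p v _ ⟩
    π p v ⊕ π p (σ p (π p v))  ≡⟨ cong (π p v ⊕_) (π∘σ p _) ⟩
    π p v ⊕ π p v              ≡⟨ ⊕-self _ ⟩
    zeroVec _                  ∎)
  where open ≡-Reasoning
... | inj₁ v⊕σπv≡0 = inj₁ (⊕≡zero⇒≡ v _ v⊕σπv≡0)
... | inj₂ v⊕σπv≡p = inj₂ (trans (sym (⊕-cancelʳ (σ p (π p v)) v)) (cong (_⊕ σ p (π p v)) v⊕σπv≡p))

infix 4 _∈⟨_⟩

record _∈⟨_⟩ (v : Vec Bool n) (b : Vec (Vec Bool n) d) : Set where
  constructor span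
  field
    coefficients : Vec Bool d
    comb≡        : comb b coefficients ≡ v

zero∈⟨⟩ : (b : Vec (Vec Bool n) d) → zeroVec n ∈⟨ b ⟩
zero∈⟨⟩ b = span (zeroVec _) (comb-zero b)

_∈⟨_⟩? : (v : Vec Bool n) (b : Vec (Vec Bool n) d) → Dec (v ∈⟨ b ⟩)
v ∈⟨ b ⟩? = map′ (λ (c , bc≡v) → span c bc≡v) (λ (span c bc≡v) → c , bc≡v)
                 (anySubset? (λ c → comb b c ≟ᵥ v))

lift : Vec Bool (suc n) → Vec (Vec Bool n) d → Vec (Vec Bool (suc n)) (suc d)
lift p b = p ∷ V.map (σ p) b

comb-lift : (p : Vec Bool (suc n)) (b : Vec (Vec Bool n) d) (x : Bool) (c : Vec Bool d) →
            comb (lift p b) (x ∷ c) ≡ (if x then p ⊕ σ p (comb b c) else σ p (comb b c))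
comb-lift p b true  c = cong (p ⊕_) (comb-map (σ-⊕ p) b c)
comb-lift p b false c = comb-map (σ-⊕ p) b c

comb-lift-head : (p : Vec Bool (suc n)) (b : Vec (Vec Bool n) d) → comb (lift p b) (true ∷ zeroVec d) ≡ p
comb-lift-head p b = begin
  comb (lift p b) (true ∷ zeroVec _)  ≡⟨ comb-lift p b true _ ⟩
  p ⊕ σ p (comb b (zeroVec _))        ≡⟨ cong (λ z → p ⊕ σ p z) (comb-zero b) ⟩
  p ⊕ σ p (zeroVec _)                 ≡⟨ cong (p ⊕_) (additive⇒zero (σ-⊕ p)) ⟩
  p ⊕ zeroVec _                       ≡⟨ ⊕-identityʳ p ⟩
  p                                   ∎
  where open ≡-Reasoning

π-comb-lift : (p : Vec Bool (suc n)) (b : Vec (Vec Bool n) d) (x : Bool) (c : Vec Bool d) →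
              π p (comb (lift p b) (x ∷ c)) ≡ comb b c
π-comb-lift p b true c = begin
  π p (comb (lift p b) (true ∷ c))  ≡⟨ cong (π p) (comb-lift p b true c) ⟩
  π p (p ⊕ σ p (comb b c))          ≡⟨ π-⊕ p p _ ⟩
  π p p ⊕ π p (σ p (comb b c))      ≡⟨ cong₂ _⊕_ (π-self p) (π∘σ p _) ⟩
  zeroVec _ ⊕ comb b c              ≡⟨ ⊕-identityˡ _ ⟩
  comb b c                          ∎
  where open ≡-Reasoning
π-comb-lift p b false c = trans (cong (π p) (comb-lift p b false c)) (π∘σ p _)

lift-linIndep : {p : Vec Bool (suc n)} → p ≢ zeroVec (suc n) →
                {b : Vec (Vec Bool n) d} → LinIndep b → LinIndep (lift p b)
lift-linIndep {p = p} p≢0 {b} b-indep (x ∷ c) comb≡0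
  with b-indep c (trans (sym (π-comb-lift p b x c)) (trans (cong (π p) comb≡0) (additive⇒zero (π-⊕ p))))
... | refl with x
...   | false = refl
...   | true  = ⊥-elim (p≢0 (trans (sym (comb-lift-head p b)) comb≡0))

lift-spans : {p : Vec Bool (suc n)} → p ≢ zeroVec (suc n) → {b : Vec (Vec Bool n) d} →
             ∀ {v} → π p v ∈⟨ b ⟩ → v ∈⟨ lift p b ⟩
lift-spans {p = p} p≢0 {b} {v} (span c bc≡πv) with π-fibre p p≢0 v
... | inj₁ v≡σπv   = span (false ∷ c)
  (trans (comb-lift p b false c) (trans (cong (σ p) bc≡πv) (sym v≡σπv)))
... | inj₂ v≡p⊕σπv = span (true ∷ c)
  (trans (comb-lift p b true c) (trans (cong (λ z → p ⊕ σ p z) bc≡πv) (sym v≡p⊕σπv)))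

-- Subspaces and dependencies

InSubspace : ℕ → Vec (Vec Bool n) m → Set
InSubspace {n} d L = Σ (Vec (Vec Bool n) d) λ b → LinIndep b × All (_∈⟨ b ⟩) L

inSubspace-lift : {p : Vec Bool (suc n)} → p ≢ zeroVec (suc n) → {L : Vec (Vec Bool (suc n)) m} →
                  InSubspace d (V.map (π p) L) → InSubspace (suc d) (p ∷ L)
inSubspace-lift {p = p} p≢0 (b , b-indep , πL⊆⟨b⟩) =
  lift p b , lift-linIndep p≢0 b-indep ,
  span (true ∷ zeroVec _) (comb-lift-head p b) ∷ All.map (lift-spans p≢0) (AllP.map⁻ πL⊆⟨b⟩)

inSubspace-zero : {L : Vec (Vec Bool n) m} → InSubspace d L → InSubspace d (zeroVec n ∷ L)
inSubspace-zero (b , b-indep , L⊆⟨b⟩) = b , b-indep , zero∈⟨⟩ b ∷ L⊆⟨b⟩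

inSubspace-[] : d ≤ n → InSubspace {n} d []
inSubspace-[] {zero}  _         = [] , (λ { [] _ → refl }) , []
inSubspace-[] {suc d} (s≤s d≤n) with inSubspace-lift {p = true ∷ zeroVec _} (λ ()) (inSubspace-[] d≤n)
... | b , b-indep , _ = b , b-indep , []

inSubspace : m ≤ d → d ≤ n → (L : Vec (Vec Bool n) m) → InSubspace d L
inSubspace _         d≤n       []      = inSubspace-[] d≤n
inSubspace (s≤s m≤d) (s≤s d≤n) (v ∷ L) with zeroView v
... | zero-vec    = inSubspace-zero (inSubspace (m≤n⇒m≤1+n m≤d) (s≤s d≤n) L)
... | nonzero v≢0 = inSubspace-lift v≢0 (inSubspace m≤d d≤n (V.map (π v) L))

IsDependency : Vec (Vec Bool n) m → Vec Bool m → Set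
IsDependency {n} {m} L c = c ≢ zeroVec m × comb L c ≡ zeroVec n

dependency-exists : n < m → (L : Vec (Vec Bool n) m) → ∃ (IsDependency L)
dependency-exists (s≤s n≤m) (v ∷ L) with zeroView v
... | zero-vec = true ∷ zeroVec _ , (λ ()) , trans (cong (_ ⊕_) (comb-zero L)) (⊕-self _)
... | nonzero v≢0 with dependency-exists n≤m (V.map (π v) L)
...   | c , c≢0 , πLc≡0 with π-kernel v v≢0 (comb L c) (trans (sym (comb-map (π-⊕ v) L c)) πLc≡0)
...     | inj₁ Lc≡0 = false ∷ c , c≢0 ∘ ∷-injectiveʳ , Lc≡0
...     | inj₂ Lc≡v = true ∷ c , (λ ()) , trans (cong (v ⊕_) Lc≡v) (⊕-self v)

comb-∷≡zero : {v : Vec Bool n} (L : Vec (Vec Bool n) m) (x : Bool) (c : Vec Bool m) →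
              comb (v ∷ L) (x ∷ c) ≡ zeroVec n → comb L c ≡ (if x then v else zeroVec n)
comb-∷≡zero L true  c v⊕Lc≡0 = sym (⊕≡zero⇒≡ _ _ v⊕Lc≡0)
comb-∷≡zero L false c Lc≡0   = Lc≡0

project-dependency : {v : Vec Bool (suc n)} → v ≢ zeroVec (suc n) → (L : Vec (Vec Bool (suc n)) m) →
                     ∀ {x c} → IsDependency (v ∷ L) (x ∷ c) → IsDependency (V.map (π v) L) c
project-dependency {v = v} v≢0 L {x} {c} (x∷c≢0 , comb≡0) =
  c≢0 x x∷c≢0 Lc≡xv , (begin
    comb (V.map (π v) L) c            ≡⟨ comb-map (π-⊕ v) L c ⟩
    π v (comb L c)                    ≡⟨ cong (π v) Lc≡xv ⟩
    π v (if x then v else zeroVec _)  ≡⟨ π-xv x ⟩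
    zeroVec _                         ∎)
  where
  open ≡-Reasoning
  Lc≡xv = comb-∷≡zero L x c comb≡0
  π-xv : ∀ x → π v (if x then v else zeroVec _) ≡ zeroVec _
  π-xv true  = π-self v
  π-xv false = additive⇒zero (π-⊕ v)
  c≢0 : ∀ x → x ∷ c ≢ zeroVec _ → comb L c ≡ (if x then v else zeroVec _) → c ≢ zeroVec _
  c≢0 true  _      Lc≡v refl = v≢0 (trans (sym Lc≡v) (comb-zero L))
  c≢0 false x∷c≢0 _    refl = x∷c≢0 refl

inSubspace-dependent : m ≤ suc d → d ≤ n → (L : Vec (Vec Bool n) m) →
                       ∀ {c} → IsDependency L c → InSubspace d L
inSubspace-dependent _ _ [] {[]} (c≢0 , _) = ⊥-elim (c≢0 refl)
inSubspace-dependent (s≤s m≤d) d≤n (v ∷ L) {x ∷ c} dep with zeroView v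
... | zero-vec = inSubspace-zero (inSubspace m≤d d≤n L)
inSubspace-dependent {d = zero} (s≤s z≤n) d≤n (v ∷ []) {x ∷ []} dep | nonzero v≢0 =
  ⊥-elim (proj₁ (project-dependency v≢0 [] dep) refl)
inSubspace-dependent {d = suc d} (s≤s m≤d) (s≤s d≤n) (v ∷ L) {x ∷ c} dep | nonzero v≢0 =
  inSubspace-lift v≢0 (inSubspace-dependent m≤d d≤n (V.map (π v) L) (project-dependency v≢0 L dep))

coordinates : {b : Vec (Vec Bool n) d} {A : Vec (Vec Bool n) p} → All (_∈⟨ b ⟩) A →
              ∃ λ (C : Vec (Vec Bool d) p) → ∀ e → comb A e ≡ comb b (comb C e)
coordinates {b = b} [] = [] , λ { [] → sym (comb-zero b) }
coordinates {b = b} (span c bc≡v ∷ A⊆⟨b⟩) with coordinates A⊆⟨b⟩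
... | C , A≡bC = c ∷ C , λ
  { (true ∷ e)  → trans (cong₂ _⊕_ (sym bc≡v) (A≡bC e)) (sym (comb-⊕ b c (comb C e)))
  ; (false ∷ e) → A≡bC e
  }

linIndep⊆span⇒≤ : {b : Vec (Vec Bool n) d} {A : Vec (Vec Bool n) p} →
                  LinIndep A → All (_∈⟨ b ⟩) A → p ≤ d
linIndep⊆span⇒≤ {d = d} {p = p} {b = b} A-indep A⊆⟨b⟩ with p ≤? d
... | yes p≤d = p≤d
... | no  p≰d with coordinates A⊆⟨b⟩
...   | C , A≡bC with dependency-exists (≰⇒> p≰d) C
...     | e , e≢0 , Ce≡0 =
  ⊥-elim (e≢0 (A-indep e (trans (A≡bC e) (trans (cong (comb b) Ce≡0) (comb-zero b)))))

select : Vec A m → (s : Vec Bool m) → Vec A ∣ s ∣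
select []       []          = []
select (x ∷ xs) (true ∷ s)  = x ∷ select xs s
select (x ∷ xs) (false ∷ s) = select xs s

All-select : {P : Pred A 0ℓ} {xs : Vec A m} → All P xs → (s : Vec Bool m) → All P (select xs s)
All-select []         []          = []
All-select (px ∷ pxs) (true ∷ s)  = px ∷ All-select pxs s
All-select (px ∷ pxs) (false ∷ s) = All-select pxs s

superset-of-size : (c : Vec Bool m) {t : ℕ} → ∣ c ∣ ≤ t → t ≤ m → ∃ λ s → c ⊆ s × ∣ s ∣ ≡ t
superset-of-size []          _         z≤n       = [] , ⊆-refl , refl
superset-of-size (true ∷ c)  (s≤s c≤t) (s≤s t≤m) with superset-of-size c c≤t t≤m
... | s , c⊆s , ∣s∣≡t = true ∷ s , in⊆in c⊆s , cong suc ∣s∣≡t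
superset-of-size {m = suc m} (false ∷ c) {t} c≤t t≤1+m with t ≤? m
... | yes t≤m with superset-of-size c c≤t t≤m
...   | s , c⊆s , ∣s∣≡t = false ∷ s , s⊆s c⊆s , ∣s∣≡t
superset-of-size {m = suc m} (false ∷ c) {t} c≤t t≤1+m | no t≰m with superset-of-size c (∣p∣≤n c) ≤-refl
...   | s , c⊆s , ∣s∣≡m = true ∷ s , out⊆ c⊆s , trans (cong suc ∣s∣≡m) (≤-antisym (≰⇒> t≰m) t≤1+m)

comb-select : {c s : Vec Bool m} → c ⊆ s → (L : Vec (Vec Bool n) m) →
              comb (select L s) (select c s) ≡ comb L c
comb-select {c = []}        {[]}        _   []      = refl
comb-select {c = true ∷ c}  {true ∷ s}  c⊆s (v ∷ L) = cong (v ⊕_) (comb-select (drop-∷-⊆ c⊆s) L)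
comb-select {c = false ∷ c} {true ∷ s}  c⊆s (v ∷ L) = comb-select (drop-∷-⊆ c⊆s) L
comb-select {c = false ∷ c} {false ∷ s} c⊆s (v ∷ L) = comb-select (drop-∷-⊆ c⊆s) L
comb-select {c = true ∷ c}  {false ∷ s} c⊆s (v ∷ L) with c⊆s here
... | ()

select≡zero : {c s : Vec Bool m} → c ⊆ s → select c s ≡ zeroVec ∣ s ∣ → c ≡ zeroVec m
select≡zero {c = []}        {[]}        _   _    = refl
select≡zero {c = x ∷ c}     {true ∷ s}  c⊆s cs≡0 =
  cong₂ _∷_ (∷-injectiveˡ cs≡0) (select≡zero (drop-∷-⊆ c⊆s) (∷-injectiveʳ cs≡0))
select≡zero {c = false ∷ c} {false ∷ s} c⊆s cs≡0 = cong (false ∷_) (select≡zero (drop-∷-⊆ c⊆s) cs≡0)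
select≡zero {c = true ∷ c}  {false ∷ s} c⊆s _ with c⊆s here
... | ()

spread : (s : Vec Bool m) → Vec Bool ∣ s ∣ → Vec Bool m
spread []          []      = []
spread (true ∷ s)  (x ∷ c) = x ∷ spread s c
spread (false ∷ s) c       = false ∷ spread s c

comb-spread : (L : Vec (Vec Bool n) m) (s : Vec Bool m) (c : Vec Bool ∣ s ∣) →
              comb L (spread s c) ≡ comb (select L s) c
comb-spread []      []          []          = refl
comb-spread (v ∷ L) (true ∷ s)  (true ∷ c)  = cong (v ⊕_) (comb-spread L s c)
comb-spread (v ∷ L) (true ∷ s)  (false ∷ c) = comb-spread L s c
comb-spread (v ∷ L) (false ∷ s) c           = comb-spread L s c

spread≡zero : (s : Vec Bool m) {c : Vec Bool ∣ s ∣} → spread s c ≡ zeroVec m → c ≡ zeroVec ∣ s ∣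
spread≡zero []          {[]}    _    = refl
spread≡zero (true ∷ s)  {x ∷ c} sc≡0 = cong₂ _∷_ (∷-injectiveˡ sc≡0) (spread≡zero s (∷-injectiveʳ sc≡0))
spread≡zero (false ∷ s)         sc≡0 = spread≡zero s (∷-injectiveʳ sc≡0)

spread≡ones : (s : Vec Bool m) {c : Vec Bool ∣ s ∣} →
              spread s c ≡ replicate m true → s ≡ replicate m true
spread≡ones []          _               = refl
spread≡ones (true ∷ s)  {_ ∷ c} sc≡ones = cong (true ∷_) (spread≡ones s (∷-injectiveʳ sc≡ones))
spread≡ones (false ∷ s) ()

select-linIndep : {L : Vec (Vec Bool n) m} → LinIndep L → (s : Vec Bool m) → LinIndep (select L s)
select-linIndep {L = L} L-indep s c Sc≡0 =
  spread≡zero s (L-indep (spread s c) (trans (comb-spread L s c) Sc≡0))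

comb-insertAt : (L : Vec (Vec Bool n) (suc m)) (c : Vec Bool m) (i : Fin (suc m)) →
                comb L (V.insertAt c i false) ≡ comb (V.removeAt L i) c
comb-insertAt (v ∷ L)     c           zero    = refl
comb-insertAt (v ∷ w ∷ L) (true ∷ c)  (suc i) = cong (v ⊕_) (comb-insertAt (w ∷ L) c i)
comb-insertAt (v ∷ w ∷ L) (false ∷ c) (suc i) = comb-insertAt (w ∷ L) c i

insertAt≡zero : {c : Vec Bool m} (i : Fin (suc m)) →
                V.insertAt c i false ≡ zeroVec (suc m) → c ≡ zeroVec m
insertAt≡zero             zero    c′≡0 = ∷-injectiveʳ c′≡0
insertAt≡zero {c = x ∷ c} (suc i) c′≡0 =
  cong₂ _∷_ (∷-injectiveˡ c′≡0) (insertAt≡zero i (∷-injectiveʳ c′≡0))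

dependency-avoiding : n < m → (L : Vec (Vec Bool n) (suc m)) (i : Fin (suc m)) →
                      ∃ λ c → IsDependency L c × V.lookup c i ≡ false
dependency-avoiding n<m L i with dependency-exists n<m (V.removeAt L i)
... | c , c≢0 , L′c≡0 =
  V.insertAt c i false , (c≢0 ∘ insertAt≡zero i , trans (comb-insertAt L c i) L′c≡0) ,
  insertAt-lookup c i false

nonzero⇒∃true : {c : Vec Bool m} → c ≢ zeroVec m → ∃ λ i → V.lookup c i ≡ true
nonzero⇒∃true {c = c} c≢0 with nonempty? c
... | yes (i , i∈c) = i , []=⇒lookup i∈c
... | no  c-empty   = ⊥-elim (c≢0 (Empty-unique c-empty))

∣a∣+∣b∣+∣a⊕b∣≤2m : (a b : Vec Bool m) → ∣ a ∣ + ∣ b ∣ + ∣ a ⊕ b ∣ ≤ 2 * m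
∣a∣+∣b∣+∣a⊕b∣≤2m []          []          = z≤n
∣a∣+∣b∣+∣a⊕b∣≤2m {suc m} (false ∷ a) (false ∷ b) = ≤-trans (∣a∣+∣b∣+∣a⊕b∣≤2m a b) (*-monoʳ-≤ 2 (n≤1+n m))
∣a∣+∣b∣+∣a⊕b∣≤2m {suc m} (true ∷ a)  (false ∷ b) =
  subst₂ _≤_ (shuffle (∣ a ∣) (∣ b ∣) (∣ a ⊕ b ∣)) (sym (*-suc 2 m)) (s≤s (s≤s (∣a∣+∣b∣+∣a⊕b∣≤2m a b)))
  where
  shuffle : ∀ x y z → 2 + (x + y + z) ≡ suc x + y + suc z
  shuffle = solve-∀
∣a∣+∣b∣+∣a⊕b∣≤2m {suc m} (false ∷ a) (true ∷ b)  =
  subst₂ _≤_ (shuffle (∣ a ∣) (∣ b ∣) (∣ a ⊕ b ∣)) (sym (*-suc 2 m)) (s≤s (s≤s (∣a∣+∣b∣+∣a⊕b∣≤2m a b)))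
  where
  shuffle : ∀ x y z → 2 + (x + y + z) ≡ x + suc y + suc z
  shuffle = solve-∀
∣a∣+∣b∣+∣a⊕b∣≤2m {suc m} (true ∷ a)  (true ∷ b)  =
  subst₂ _≤_ (shuffle (∣ a ∣) (∣ b ∣) (∣ a ⊕ b ∣)) (sym (*-suc 2 m)) (s≤s (s≤s (∣a∣+∣b∣+∣a⊕b∣≤2m a b)))
  where
  shuffle : ∀ x y z → 2 + (x + y + z) ≡ suc x + suc y + z
  shuffle = solve-∀

one-of-three-≤-third : ∀ {t} x y z → x + y + z ≤ t → 3 * x ≤ t ⊎ 3 * y ≤ t ⊎ 3 * z ≤ t
one-of-three-≤-third {t} x y z x+y+z≤t with 3 * x ≤? t | 3 * y ≤? t | 3 * z ≤? t
... | yes 3x≤t | _        | _        = inj₁ 3x≤t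
... | no  _    | yes 3y≤t | _        = inj₂ (inj₁ 3y≤t)
... | no  _    | no  _    | yes 3z≤t = inj₂ (inj₂ 3z≤t)
... | no  3x≰t | no  3y≰t | no  3z≰t = ⊥-elim (<-irrefl refl (begin-strict
  3 * t                  ≡⟨ thrice t ⟩
  t + t + t              <⟨ +-mono-< (+-mono-< (≰⇒> 3x≰t) (≰⇒> 3y≰t)) (≰⇒> 3z≰t) ⟩
  3 * x + 3 * y + 3 * z  ≡⟨ distrib x y z ⟩
  3 * (x + y + z)        ≤⟨ *-monoʳ-≤ 3 x+y+z≤t ⟩
  3 * t                  ∎))
  where
  open ≤-Reasoning
  thrice : ∀ t → 3 * t ≡ t + t + t
  thrice = solve-∀
  distrib : ∀ x y z → 3 * x + 3 * y + 3 * z ≡ 3 * (x + y + z)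
  distrib = solve-∀

light-dependency : 2 + n ≤ m → (L : Vec (Vec Bool n) m) → ∃ λ c → IsDependency L c × 3 * ∣ c ∣ ≤ 2 * m
light-dependency {m = suc m} (s≤s n<m) L with dependency-exists (m≤n⇒m≤1+n n<m) L
... | a , a≢0 , La≡0 with nonzero⇒∃true a≢0
...   | i , aᵢ≡true with dependency-avoiding n<m L i
...     | b , (b≢0 , Lb≡0) , bᵢ≡false
          with one-of-three-≤-third (∣ a ∣) (∣ b ∣) (∣ a ⊕ b ∣) (∣a∣+∣b∣+∣a⊕b∣≤2m a b)
...       | inj₁ 3∣a∣≤2m        = a , (a≢0 , La≡0) , 3∣a∣≤2m
...       | inj₂ (inj₁ 3∣b∣≤2m) = b , (b≢0 , Lb≡0) , 3∣b∣≤2m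
...       | inj₂ (inj₂ 3∣a⊕b∣≤2m) = a ⊕ b , (a⊕b≢0 , L[a⊕b]≡0) , 3∣a⊕b∣≤2m
  where
  a⊕b≢0 : a ⊕ b ≢ zeroVec _
  a⊕b≢0 a⊕b≡0 with trans (sym aᵢ≡true) (trans (cong (λ c → V.lookup c i) (⊕≡zero⇒≡ a b a⊕b≡0)) bᵢ≡false)
  ... | ()
  L[a⊕b]≡0 : comb L (a ⊕ b) ≡ zeroVec _
  L[a⊕b]≡0 = trans (comb-⊕ L a b) (trans (cong₂ _⊕_ La≡0 Lb≡0) (⊕-self _))

dependency⇒inSubspace : (L : Vec (Vec Bool n) m) → ∀ {c} → IsDependency L c →
                        ∣ c ∣ ≤ suc d → suc d ≤ m → d ≤ n →
                        ∃ λ s → ∣ s ∣ ≡ suc d × InSubspace d (select L s)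
dependency⇒inSubspace L {c} (c≢0 , Lc≡0) ∣c∣≤1+d 1+d≤m d≤n with superset-of-size c ∣c∣≤1+d 1+d≤m
... | s , c⊆s , ∣s∣≡1+d =
  s , ∣s∣≡1+d ,
  inSubspace-dependent (≤-reflexive ∣s∣≡1+d) d≤n (select L s)
    (c≢0 ∘ select≡zero c⊆s , trans (comb-select c⊆s L) Lc≡0)

-- Counting points with multiplicity

δ : Vec Bool n → Vec Bool n → ℕ
δ u w with u ≟ᵥ w
... | yes _ = 1
... | no  _ = 0

δ-≡ : {u w : Vec Bool n} → u ≡ w → δ u w ≡ 1
δ-≡ {u = u} {w} u≡w with u ≟ᵥ w
... | yes _   = refl
... | no  u≢w = ⊥-elim (u≢w u≡w)

δ-≢ : {u w : Vec Bool n} → u ≢ w → δ u w ≡ 0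
δ-≢ {u = u} {w} u≢w with u ≟ᵥ w
... | yes u≡w = ⊥-elim (u≢w u≡w)
... | no  _   = refl

δ-mono : {n′ : ℕ} {u w : Vec Bool n} {u′ w′ : Vec Bool n′} → (u ≡ w → u′ ≡ w′) → δ u w ≤ δ u′ w′
δ-mono {u = u} {w} u≡w⇒u′≡w′ with u ≟ᵥ w
... | yes u≡w = ≤-reflexive (sym (δ-≡ (u≡w⇒u′≡w′ u≡w)))
... | no  _   = z≤n

δ-cong : {n′ : ℕ} {u w : Vec Bool n} {u′ w′ : Vec Bool n′} →
         (u ≡ w → u′ ≡ w′) → (u′ ≡ w′ → u ≡ w) → δ u w ≡ δ u′ w′
δ-cong ⇒ ⇐ = ≤-antisym (δ-mono ⇒) (δ-mono ⇐)

∑-allVecs-δ : (g : Vec Bool n → ℕ) (w : Vec Bool n) → ∑[ u ∈ allVecs n ] g u * δ u w ≡ g w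
∑-allVecs-δ g [] = trans (+-identityʳ _) (trans (cong (g [] *_) (δ-≡ {u = []} refl)) (*-identityʳ _))
∑-allVecs-δ {suc n} g (y ∷ w) = begin
  ∑ (L.map (false ∷_) Vs ++ L.map (true ∷_) Vs) F       ≡⟨ ∑-++ (L.map (false ∷_) Vs) _ F ⟩
  ∑ (L.map (false ∷_) Vs) F + ∑ (L.map (true ∷_) Vs) F  ≡⟨ cong₂ _+_ (∑-map _ Vs F) (∑-map _ Vs F) ⟩
  ∑ Vs (F ∘ (false ∷_)) + ∑ Vs (F ∘ (true ∷_))          ≡⟨ halves y ⟩
  g (y ∷ w)                                             ∎
  where
  open ≡-Reasoning
  Vs = allVecs n
  F = λ u → g u * δ u (y ∷ w)
  same : ∀ x → ∑[ u ∈ Vs ] g (x ∷ u) * δ (x ∷ u) (x ∷ w) ≡ g (x ∷ w)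
  same x = trans (∑-cong (λ u → cong (g (x ∷ u) *_) (δ-cong ∷-injectiveʳ (cong (x ∷_)))) Vs)
                 (∑-allVecs-δ (g ∘ (x ∷_)) w)
  other : ∀ x y → x ≢ y → ∑[ u ∈ Vs ] g (x ∷ u) * δ (x ∷ u) (y ∷ w) ≡ 0
  other x y x≢y =
    ∑-zero (λ u → trans (cong (g (x ∷ u) *_) (δ-≢ (x≢y ∘ ∷-injectiveˡ))) (*-zeroʳ (g (x ∷ u)))) Vs
  halves : ∀ y → (∑[ u ∈ Vs ] g (false ∷ u) * δ (false ∷ u) (y ∷ w))
               + (∑[ u ∈ Vs ] g (true ∷ u) * δ (true ∷ u) (y ∷ w)) ≡ g (y ∷ w)
  halves false = trans (cong₂ _+_ (same false) (other true false (λ ()))) (+-identityʳ _)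
  halves true  = cong₂ _+_ (other false true (λ ())) (same true)

∑-allVecs-δ≡1 : (w : Vec Bool n) → ∑[ u ∈ allVecs n ] δ w u ≡ 1
∑-allVecs-δ≡1 {n} w =
  trans (∑-cong (λ u → trans (δ-cong sym sym) (sym (*-identityˡ _))) (allVecs n))
        (∑-allVecs-δ (λ _ → 1) w)

∑-nonzeroVecs-≤ : (f : Vec Bool n → ℕ) → ∑ (nonzeroVecs n) f ≤ ∑ (allVecs n) f
∑-nonzeroVecs-≤ {n} f = ∑-filter-≤ (λ v → ¬? (v ≟ᵥ zeroVec n)) f (allVecs n)

∑-nonzeroVecs : (f : Vec Bool n → ℕ) → f (zeroVec n) ≡ 0 → ∑ (nonzeroVecs n) f ≡ ∑ (allVecs n) f
∑-nonzeroVecs {n} f f0≡0 = ∑-filter (λ v → ¬? (v ≟ᵥ zeroVec n)) f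
  (λ v ¬v≢0 → trans (cong f (decidable-stable (v ≟ᵥ zeroVec n) ¬v≢0)) f0≡0) (allVecs n)

∑-nonzeroVecs-δ≡1 : {w : Vec Bool n} → w ≢ zeroVec n → ∑[ u ∈ nonzeroVecs n ] δ w u ≡ 1
∑-nonzeroVecs-δ≡1 {w = w} w≢0 = trans (∑-nonzeroVecs (δ w) (δ-≢ w≢0)) (∑-allVecs-δ≡1 w)

∑-nonzeroVecs-δ≤1 : (w : Vec Bool n) → ∑[ u ∈ nonzeroVecs n ] δ w u ≤ 1
∑-nonzeroVecs-δ≤1 w = ≤-trans (∑-nonzeroVecs-≤ (δ w)) (≤-reflexive (∑-allVecs-δ≡1 w))

multiplicity : Vec (Vec Bool n) p → Vec Bool n → ℕ
multiplicity W w = ∑[ ℓ ∈ V.toList W ] δ ℓ w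

totalMult-multiplicity : {N : ℕ} {W : Vec (Vec Bool (suc N)) p} →
                         All (_≢ zeroVec _) W → totalMult (multiplicity W) ≡ p
totalMult-multiplicity {N = N} [] = ∑-zero (λ _ → refl) (points N)
totalMult-multiplicity {N = N} {W = ℓ ∷ W} (ℓ≢0 ∷ W≢0) =
  trans (∑-+ (δ ℓ) (multiplicity W) (points N))
        (cong₂ _+_ (∑-nonzeroVecs-δ≡1 ℓ≢0) (totalMult-multiplicity W≢0))

module _ {N r : ℕ} {b : Vec (Vec Bool (suc N)) (suc r)} where

  1≤subspaceMult-δ : {ℓ : Vec Bool (suc N)} → ℓ ≢ zeroVec _ → ℓ ∈⟨ b ⟩ → 1 ≤ subspaceMult (δ ℓ) b
  1≤subspaceMult-δ ℓ≢0 (span c₀ bc₀≡ℓ) = begin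
    1                              ≡⟨ ∑-nonzeroVecs-δ≡1 c₀≢0 ⟨
    ∑[ c ∈ nonzeroVecs _ ] δ c₀ c  ≤⟨ ∑-mono (λ c → δ-mono (c₀≡c⇒ℓ≡bc c)) (nonzeroVecs (suc r)) ⟩
    subspaceMult (δ _) b           ∎
    where
    open ≤-Reasoning
    c₀≡c⇒ℓ≡bc : ∀ c → c₀ ≡ c → _ ≡ comb b c
    c₀≡c⇒ℓ≡bc c c₀≡c = trans (sym bc₀≡ℓ) (cong (comb b) c₀≡c)
    c₀≢0 : c₀ ≢ zeroVec _
    c₀≢0 refl = ℓ≢0 (trans (sym bc₀≡ℓ) (comb-zero b))

  subspaceMult-δ≤1 : LinIndep b → {ℓ : Vec Bool (suc N)} → ℓ ∈⟨ b ⟩ → subspaceMult (δ ℓ) b ≤ 1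
  subspaceMult-δ≤1 b-indep (span c₀ bc₀≡ℓ) = begin
    subspaceMult (δ _) b           ≤⟨ ∑-mono (λ c → δ-mono (ℓ≡bc⇒c₀≡c c)) (nonzeroVecs (suc r)) ⟩
    ∑[ c ∈ nonzeroVecs _ ] δ c₀ c  ≤⟨ ∑-nonzeroVecs-δ≤1 c₀ ⟩
    1                              ∎
    where
    open ≤-Reasoning
    ℓ≡bc⇒c₀≡c : ∀ c → _ ≡ comb b c → c₀ ≡ c
    ℓ≡bc⇒c₀≡c c ℓ≡bc = comb-injective {L = b} b-indep c₀ c (trans bc₀≡ℓ ℓ≡bc)

  subspaceMult-δ≡0 : {ℓ : Vec Bool (suc N)} → ¬ ℓ ∈⟨ b ⟩ → subspaceMult (δ ℓ) b ≡ 0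
  subspaceMult-δ≡0 ℓ∉⟨b⟩ = ∑-zero (λ c → δ-≢ (λ ℓ≡bc → ℓ∉⟨b⟩ (span c (sym ℓ≡bc)))) (nonzeroVecs (suc r))

  subspaceMult-multiplicity-∷ : (ℓ : Vec Bool (suc N)) (W : Vec (Vec Bool (suc N)) p) →
    subspaceMult (multiplicity (ℓ ∷ W)) b ≡ subspaceMult (δ ℓ) b + subspaceMult (multiplicity W) b
  subspaceMult-multiplicity-∷ ℓ W =
    ∑-+ (λ c → δ ℓ (comb b c)) (λ c → multiplicity W (comb b c)) (nonzeroVecs (suc r))

  length≤subspaceMult-multiplicity : {W : Vec (Vec Bool (suc N)) p} →
    All (_≢ zeroVec _) W → All (_∈⟨ b ⟩) W → p ≤ subspaceMult (multiplicity W) b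
  length≤subspaceMult-multiplicity []                 []                  = z≤n
  length≤subspaceMult-multiplicity {W = ℓ ∷ W} (ℓ≢0 ∷ W≢0) (ℓ∈⟨b⟩ ∷ W⊆⟨b⟩) = begin
    suc _                                                   ≤⟨ +-mono-≤ (1≤subspaceMult-δ ℓ≢0 ℓ∈⟨b⟩) W≤ ⟩
    subspaceMult (δ ℓ) b + subspaceMult (multiplicity W) b  ≡⟨ subspaceMult-multiplicity-∷ ℓ W ⟨
    subspaceMult (multiplicity (ℓ ∷ W)) b                   ∎
    where
    open ≤-Reasoning
    W≤ = length≤subspaceMult-multiplicity W≢0 W⊆⟨b⟩

  length≤subspaceMult : {M : Multiset N} {W : Vec (Vec Bool (suc N)) p} →
    All (_≢ zeroVec _) W → All (_∈⟨ b ⟩) W → (∀ v → multiplicity W v ≤ M v) → p ≤ subspaceMult M b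
  length≤subspaceMult W≢0 W⊆⟨b⟩ W≤M =
    ≤-trans (length≤subspaceMult-multiplicity W≢0 W⊆⟨b⟩)
            (∑-mono (λ c → W≤M (comb b c)) (nonzeroVecs (suc r)))

  subspaceMult-multiplicity≤spanned : LinIndep b → (W : Vec (Vec Bool (suc N)) p) →
    ∃ λ s → All (_∈⟨ b ⟩) (select W s) × subspaceMult (multiplicity W) b ≤ ∣ s ∣
  subspaceMult-multiplicity≤spanned b-indep []      =
    [] , [] , ≤-reflexive (∑-zero (λ _ → refl) (nonzeroVecs (suc r)))
  subspaceMult-multiplicity≤spanned b-indep (ℓ ∷ W)
    with subspaceMult-multiplicity≤spanned b-indep W | ℓ ∈⟨ b ⟩?
  ... | s , S⊆⟨b⟩ , W≤∣s∣ | yes ℓ∈⟨b⟩ = true ∷ s , ℓ∈⟨b⟩ ∷ S⊆⟨b⟩ ,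
    ≤-trans (≤-reflexive (subspaceMult-multiplicity-∷ ℓ W))
            (+-mono-≤ (subspaceMult-δ≤1 b-indep ℓ∈⟨b⟩) W≤∣s∣)
  ... | s , S⊆⟨b⟩ , W≤∣s∣ | no  ℓ∉⟨b⟩ = false ∷ s , S⊆⟨b⟩ ,
    ≤-trans (≤-reflexive (trans (subspaceMult-multiplicity-∷ ℓ W) (cong (_+ _) (subspaceMult-δ≡0 ℓ∉⟨b⟩))))
            W≤∣s∣

-- Lower bound: the frame

units : (k : ℕ) → Vec (Vec Bool k) k
units zero    = []
units (suc k) = (true ∷ zeroVec k) ∷ V.map (false ∷_) (units k)

comb-units : (c : Vec Bool m) → comb (units m) c ≡ c
comb-units []          = refl
comb-units (true ∷ c)  = trans (cong ((true ∷ zeroVec _) ⊕_) (comb-map (λ _ _ → refl) (units _) c))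
                               (cong (true ∷_) (trans (⊕-identityˡ _) (comb-units c)))
comb-units (false ∷ c) = trans (comb-map (λ _ _ → refl) (units _) c) (cong (false ∷_) (comb-units c))

units-linIndep : LinIndep (units m)
units-linIndep c units·c≡0 = trans (sym (comb-units c)) units·c≡0

selected-units-linIndep : (s : Vec Bool m) → LinIndep (select (units m) s)
selected-units-linIndep = select-linIndep {L = units _} units-linIndep

ones∷units-linIndep : (s : Vec Bool m) → s ≢ replicate m true →
                      LinIndep (replicate m true ∷ select (units m) s)
ones∷units-linIndep s s≢ones (false ∷ c) Sc≡0 = cong (false ∷_) (selected-units-linIndep s c Sc≡0)
ones∷units-linIndep s s≢ones (true ∷ c) ones⊕Sc≡0 = ⊥-elim (s≢ones (spread≡ones s (begin
  spread s c                   ≡⟨ comb-units (spread s c) ⟨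
  comb (units _) (spread s c)  ≡⟨ comb-spread (units _) s c ⟩
  comb (select (units _) s) c  ≡⟨ ⊕≡zero⇒≡ _ _ ones⊕Sc≡0 ⟨
  replicate _ true             ∎)))
  where open ≡-Reasoning

frame : (k : ℕ) → Vec (Vec Bool k) (suc k)
frame k = replicate k true ∷ units k

frame-nonzero : (N : ℕ) → All (_≢ zeroVec (suc N)) (frame (suc N))
frame-nonzero N = (λ ()) ∷ linIndep⇒nonzero units-linIndep

frame-select-≤ : d < m → (b : Vec (Vec Bool m) d) (s : Vec Bool (suc m)) →
                 All (_∈⟨ b ⟩) (select (frame m) s) → ∣ s ∣ ≤ d
frame-select-≤ d<m b (false ∷ s) S⊆⟨b⟩ = linIndep⊆span⇒≤ (selected-units-linIndep s) S⊆⟨b⟩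
frame-select-≤ {m = m} d<m b (true ∷ s) (ones∈⟨b⟩ ∷ S⊆⟨b⟩) with s ≟ᵥ replicate m true
... | yes refl  =
  ⊥-elim (<⇒≱ d<m (subst (_≤ _) (∣⊤∣≡n m) (linIndep⊆span⇒≤ (selected-units-linIndep _) S⊆⟨b⟩)))
... | no s≢ones = linIndep⊆span⇒≤ (ones∷units-linIndep s s≢ones) (ones∈⟨b⟩ ∷ S⊆⟨b⟩)

frame-admissible : {N r : ℕ} → r < N → Admissible N r (suc r) (multiplicity (frame (suc N)))
frame-admissible {N} r<N b b-indep with subspaceMult-multiplicity≤spanned b-indep (frame (suc N))
... | s , S⊆⟨b⟩ , mult≤∣s∣ = ≤-trans mult≤∣s∣ (frame-select-≤ (s≤s r<N) b s S⊆⟨b⟩)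

-- Upper bound

multiplicity-++ : (U : Vec (Vec Bool n) p) (W : Vec (Vec Bool n) m) (w : Vec Bool n) →
                  multiplicity (U V.++ W) w ≡ multiplicity U w + multiplicity W w
multiplicity-++ U W w =
  trans (cong (λ ℓs → ∑[ ℓ ∈ ℓs ] δ ℓ w) (toList-++ U W)) (∑-++ (V.toList U) (V.toList W) (λ ℓ → δ ℓ w))

multiplicity-replicate : (k : ℕ) (u w : Vec Bool n) → multiplicity (replicate k u) w ≡ k * δ u w
multiplicity-replicate zero    u w = refl
multiplicity-replicate (suc k) u w = cong (δ u w +_) (multiplicity-replicate k u w)

multiplicity-select-≤ : (W : Vec (Vec Bool n) m) (s : Vec Bool m) (w : Vec Bool n) →
                        multiplicity (select W s) w ≤ multiplicity W w
multiplicity-select-≤ []      []          w = z≤n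
multiplicity-select-≤ (ℓ ∷ W) (true ∷ s)  w = +-monoʳ-≤ (δ ℓ w) (multiplicity-select-≤ W s w)
multiplicity-select-≤ (ℓ ∷ W) (false ∷ s) w = ≤-trans (multiplicity-select-≤ W s w) (m≤n+m _ (δ ℓ w))

takeVec : {t : ℕ} → t ≤ m → Vec A m → Vec A t
takeVec z≤n       _        = []
takeVec (s≤s t≤m) (x ∷ xs) = x ∷ takeVec t≤m xs

All-takeVec : {P : Pred A 0ℓ} {t : ℕ} (t≤m : t ≤ m) {xs : Vec A m} → All P xs → All P (takeVec t≤m xs)
All-takeVec z≤n       _          = []
All-takeVec (s≤s t≤m) (px ∷ pxs) = px ∷ All-takeVec t≤m pxs

multiplicity-takeVec-≤ : {t : ℕ} (t≤m : t ≤ m) (W : Vec (Vec Bool n) m) (w : Vec Bool n) →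
                         multiplicity (takeVec t≤m W) w ≤ multiplicity W w
multiplicity-takeVec-≤ z≤n       _       w = z≤n
multiplicity-takeVec-≤ (s≤s t≤m) (ℓ ∷ W) w = +-monoʳ-≤ (δ ℓ w) (multiplicity-takeVec-≤ t≤m W w)

expand : (M : Vec Bool n → ℕ) (us : List (Vec Bool n)) → Vec (Vec Bool n) (∑ us M)
expand M []       = []
expand M (u ∷ us) = replicate (M u) u V.++ expand M us

multiplicity-expand : (M : Vec Bool n → ℕ) (us : List (Vec Bool n)) (w : Vec Bool n) →
                      multiplicity (expand M us) w ≡ ∑[ u ∈ us ] M u * δ u w
multiplicity-expand M []       w = refl
multiplicity-expand M (u ∷ us) w =
  trans (multiplicity-++ (replicate (M u) u) (expand M us) w)
        (cong₂ _+_ (multiplicity-replicate (M u) u w) (multiplicity-expand M us w))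

All-expand : {P : Pred (Vec Bool n) 0ℓ} (M : Vec Bool n → ℕ) {us : List (Vec Bool n)} →
             ListAll.All P us → All P (expand M us)
All-expand M ListAll.[]                  = []
All-expand M {u ∷ us} (pu ListAll.∷ pus) = AllP.++⁺ (All-replicate (M u)) (All-expand M pus)
  where
  All-replicate : ∀ k → All _ (replicate k u)
  All-replicate zero    = []
  All-replicate (suc k) = pu ∷ All-replicate k

pick-points : {N t : ℕ} (M : Multiset N) → t ≤ totalMult M →
              Σ (Vec (Vec Bool (suc N)) t) λ W → All (_≢ zeroVec _) W × (∀ v → multiplicity W v ≤ M v)
pick-points {N} M t≤total =
  takeVec t≤total E ,
  All-takeVec t≤total (All-expand M (ListAllP.all-filter (λ v → ¬? (v ≟ᵥ zeroVec _)) (allVecs _))) ,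
  λ v → begin
    multiplicity (takeVec t≤total E) v    ≤⟨ multiplicity-takeVec-≤ t≤total E v ⟩
    multiplicity E v                      ≡⟨ multiplicity-expand M (points N) v ⟩
    ∑[ u ∈ points N ] M u * δ u v         ≤⟨ ∑-nonzeroVecs-≤ (λ u → M u * δ u v) ⟩
    ∑[ u ∈ allVecs (suc N) ] M u * δ u v  ≡⟨ ∑-allVecs-δ M v ⟩
    M v                                   ∎
  where
  open ≤-Reasoning
  E = expand M (points N)

crowded-subspace : (j : ℕ) (W : Vec (Vec Bool (5 + j)) (7 + j)) →
                   ∃ λ s → ∣ s ∣ ≡ 4 + j × InSubspace (3 + j) (select W s)
crowded-subspace j W with light-dependency ≤-refl W
... | c , dep , 3∣c∣≤2[7+j] = dependency⇒inSubspace W dep ∣c∣≤4+j (m≤n+m (4 + j) 3) (m≤n+m (3 + j) 2)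
  where
  3[5+j]≡ : ∀ j → 3 * (5 + j) ≡ suc (2 * (7 + j)) + j
  3[5+j]≡ = solve-∀
  ∣c∣≤4+j : ∣ c ∣ ≤ 4 + j
  ∣c∣≤4+j = ≤-pred (*-cancelˡ-< 3 (∣ c ∣) (5 + j)
              (≤-<-trans 3∣c∣≤2[7+j] (subst (2 * (7 + j) <_) (sym (3[5+j]≡ j)) (m≤m+n _ j))))

crowded⇒¬admissible : {N r w : ℕ} {M : Multiset N} {W : Vec (Vec Bool (suc N)) p} →
                      All (_≢ zeroVec _) W → (∀ v → multiplicity W v ≤ M v) →
                      (∃ λ s → ∣ s ∣ ≡ suc w × InSubspace (suc r) (select W s)) → ¬ Admissible N r w M
crowded⇒¬admissible {W = W} W≢0 W≤M (s , ∣s∣≡1+w , b , b-indep , S⊆⟨b⟩) adm =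
  <⇒≱ (subst (_≤ _) ∣s∣≡1+w (length≤subspaceMult (All-select W≢0 s) S⊆⟨b⟩
         (λ v → ≤-trans (multiplicity-select-≤ W s v) (W≤M v))))
      (adm b b-indep)

upper-bound : (j : ℕ) (M : Multiset (4 + j)) → Admissible (4 + j) (2 + j) (3 + j) M → totalMult M ≤ 6 + j
upper-bound j M adm with 7 + j ≤? totalMult M
... | no  7+j≰total = ≤-pred (≰⇒> 7+j≰total)
... | yes 7+j≤total with pick-points M 7+j≤total
...   | W , W≢0 , W≤M = ⊥-elim (crowded⇒¬admissible W≢0 W≤M (crowded-subspace j W) adm)

mainTheorem13 : (k : ℕ) → 5 ≤ k → IsM2 (k ∸ 3) (k ∸ 1) (k ∸ 2) (k + 1)
mainTheorem13 _ (s≤s (s≤s (s≤s (s≤s (s≤s (z≤n {j})))))) =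
  ( multiplicity (frame (5 + j))
  , frame-admissible (n≤1+n (3 + j))
  , trans (totalMult-multiplicity (frame-nonzero (4 + j))) 6+j≡k+1
  ) ,
  λ M adm → subst (totalMult M ≤_) 6+j≡k+1 (upper-bound j M adm)
  where
  6+j≡k+1 : 6 + j ≡ 5 + j + 1
  6+j≡k+1 = cong (5 +_) (+-comm 1 j)
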